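{- Let $G$ be a graph on $n$ vertices, $S$ a cluster deletion set of $G$, and $S'$ an extended deletion set (with respect to $S$). Then there exists an ordering $\pi:V(G)\to[n]$ of stretch equal to $\mathrm{bw}(G)$ such that for every $s\in S$, the set $S'$ contains vertices $v^s_{\min}$ and $v^s_{\max}$ with $\pi(v^s_{\min})=\min\{\pi(u):u\in N(s)\}$ and $\pi(v^s_{\max})=\max\{\pi(u):u\in N(s)\}$, i.e. $S'$ contains the leftmost and the rightmost neighbor of $s$ under $\pi$.
   Context: Graphs are finite, simple, undirected. An ordering of $G$ is a bijection $\pi:V(G)\to[n]$, $[n]=\{1,\dots,n\}$; the stretch of $\pi$ is $\max_{\{u,v\}\in E(G)}|\pi(u)-\pi(v)|$, and $\mathrm{bw}(G)$ is the minimum stretch of an ordering of $G$. $\omega(G)$ is the clique number. A cluster deletion set is a set $S\subseteq V(G)$ such that every connected component of $G-S$ is a clique; these components are called clusters. For $v\notin S$ let $N_S(v)=N(v)\cap S$. Let $k=|S|$ and let $\mathcal K$ be the set of vectors $\kappa\in\mathbb N^{2^k}$, with entries indexed by subsets of $S$, such that $\sum_N\kappa_N\le\omega(G)$. A cluster $C$ has cluster-type $\kappa$ if $|\{v\in V(C):N_S(v)=N\}|=\kappa_N$ for every $N\subseteq S$; $\#\kappa$ denotes the number of clusters of cluster-type $\kappa$. A set $\mathcal C$ of clusters is representative if, for every $\kappa\in\mathcal K$, it consists of exactly $\min\{2|S|,\#\kappa\}$ distinct clusters of type $\kappa$. A set $S'$ is an extended deletion set if $S'=S\cup\bigcup_{C\in\mathcal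 C}V(C)$ for some representative set $\mathcal C$ of clusters. -}

module Defs where

open import Data.Bool using (Bool; true; false; _∧_; if_then_else_)
open import Data.Nat using (ℕ; zero; suc; _≤_; _⊔_; _⊓_; _*_; ∣_-_∣)
open import Data.Fin using (Fin; toℕ)
open import Data.Fin.Subset using (Subset; _∈_; _∉_; _⊆_; _∩_; _∪_; ⋃; ∣_∣; inside; outside)
open import Data.Fin.Subset.Properties using (_⊆?_)
open import Data.Fin.Permutation using (Permutation′; _⟨$⟩ʳ_)
open import Data.Vec using (Vec; []; _∷_; tabulate; lookup)
open import Data.Vec.Properties using (≡-dec)
open import Data.List using (List; []; _∷_; map; _++_; filter; foldr; length; allFin)
open import Data.Nat.ListAction using (sum)
open import Data.List.Relation.Unary.Unique.Propositional using (Unique)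
open import Data.List.Relation.Unary.All using (All)
open import Data.List.Membership.Propositional using () renaming (_∈_ to _∈L_)
import Data.Bool as B
open import Data.Product using (Σ; ∃; _×_; _,_)
open import Data.Sum using (_⊎_)
open import Relation.Nullary using (¬_; does)
open import Relation.Binary.PropositionalEquality using (_≡_)
open import Function.Bundles using (_⇔_)

record Graph (n : ℕ) : Set where
  field
    adj    : Fin n → Fin n → Bool
    sym    : ∀ u v → adj u v ≡ adj v u
    irrefl : ∀ v → adj v v ≡ false

module _ {n : ℕ} (G : Graph n) where
  open Graph G

  Adj : Fin n → Fin n → Set
  Adj u v = adj u v ≡ true

  allSubsets : (m : ℕ) → List (Subset m)
  allSubsets zero = [] ∷ []
  allSubsets (suc m) = map (inside ∷_) (allSubsets m) ++ map (outside ∷_) (allSubsets m)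

  isClique : Subset n → Bool
  isClique C = foldr _∧_ true
    (map (λ u → foldr _∧_ true
      (map (λ v → if lookup C u ∧ lookup C v ∧ B.not (does (u Data.Fin.≟ v))
                  then adj u v else true) (allFin n))) (allFin n))

  ω : ℕ
  ω = foldr _⊔_ 0 (map ∣_∣ (filter (λ C → isClique C B.≟ true) (allSubsets n)))

  -- orderings, stretch, bandwidth
  -- ordering π : V(G) → [n], encoded as a permutation of Fin n (position toℕ (π v) + 1)
  pos : Permutation′ n → Fin n → ℕ
  pos π v = toℕ (π ⟨$⟩ʳ v)

  stretch : Permutation′ n → ℕ
  stretch π = foldr _⊔_ 0
    (map (λ u → foldr _⊔_ 0
      (map (λ v → if adj u v then ∣ pos π u - pos π v ∣ else 0) (allFin n))) (allFin n))

  -- stretch π equals bw(G) = min over orderings of the stretch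
  HasBandwidthStretch : Permutation′ n → Set
  HasBandwidthStretch π = ∀ (σ : Permutation′ n) → stretch π ≤ stretch σ

  data Reach (S : Subset n) (u : Fin n) : Fin n → Set where
    here : u ∉ S → Reach S u u
    step : ∀ {v w} → Reach S u v → w ∉ S → Adj v w → Reach S u w

  IsClusterDeletionSet : Subset n → Set
  IsClusterDeletionSet S = ∀ u v → Reach S u v → u ≡ v ⊎ Adj u v

  IsCluster : Subset n → Subset n → Set
  IsCluster S C = Σ (Fin n) λ r → r ∉ S × (∀ v → (v ∈ C) ⇔ Reach S r v)

  NS : Subset n → Fin n → Subset n
  NS S v = tabulate (λ s → lookup S s ∧ adj v s)

  typeCount : Subset n → Subset n → Subset n → ℕ
  typeCount S C N = ∣ C ∩ tabulate (λ v → does (≡-dec B._≟_ (NS S v) N)) ∣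

  -- cluster-type vectors κ, indexed by subsets N ⊆ S (entries at N ⊄ S are ignored)
  ClusterTypeVec : Set
  ClusterTypeVec = Subset n → ℕ

  InK : Subset n → ClusterTypeVec → Set
  InK S κ = sum (map κ (filter (_⊆? S) (allSubsets n))) ≤ ω

  HasType : Subset n → ClusterTypeVec → Subset n → Set
  HasType S κ C = ∀ N → N ⊆ S → typeCount S C N ≡ κ N

  NumClusters : Subset n → ClusterTypeVec → ℕ → Set
  NumClusters S κ m = Σ (List (Subset n)) λ L →
    Unique L × (∀ C → (C ∈L L) ⇔ (IsCluster S C × HasType S κ C)) × length L ≡ m

data Count {A : Set} (P : A → Set) : List A → ℕ → Set where
  nil  : Count P [] 0
  yes∷ : ∀ {x xs m} → P x → Count P xs m → Count P (x ∷ xs) (suc m)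
  no∷  : ∀ {x xs m} → ¬ P x → Count P xs m → Count P (x ∷ xs) m

module _ {n : ℕ} (G : Graph n) where

  IsRepresentative : Subset n → List (Subset n) → Set
  IsRepresentative S 𝒞 =
    Unique 𝒞 × All (IsCluster G S) 𝒞 ×
    (∀ κ → InK G S κ → ∀ m → NumClusters G S κ m →
       Count (HasType G S κ) 𝒞 (2 * ∣ S ∣ ⊓ m))

  IsExtendedDeletionSet : Subset n → Subset n → Set
  IsExtendedDeletionSet S S' =
    Σ (List (Subset n)) λ 𝒞 → IsRepresentative S 𝒞 × S' ≡ S ∪ ⋃ 𝒞

{-# OPTIONS --safe #-}
module Submission where

-- Start from an ordering of minimum stretch and call a slot (s, side), s ∈ S, bad if the leftmost or
-- rightmost neighbour x of s lies outside S'.  Then x ∉ S and its cluster C is not in 𝒞, so the type κ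
-- of C has more than min(2|S|, #κ) clusters and 𝒞 contains exactly 2|S| of them.  Only 2|S| vertices are
-- extreme neighbours of vertices of S, and x is one of them lying outside 𝒞, so some type-κ cluster D ∈ 𝒞
-- contains none.  Exchanging C and D, matching vertices with equal neighbourhoods in S, is an automorphism
-- of G.  Reordering by it keeps the stretch, moves the extreme neighbour of the bad slot into D ⊆ S', and
-- fixes every extreme neighbour already in S'.  So the number of bad slots drops until it is zero.

open import Defs
open import Data.Nat using (ℕ; _≤_)
open import Data.Fin using (Fin)
open import Data.Fin.Subset using (Subset; _∈_)
open import Data.Fin.Permutation using (Permutation′)
open import Data.Product using (Σ; ∃; _×_)
open import Relation.Binary.PropositionalEquality using (_≡_)

open import Data.Bool using (Bool; true; false; _∧_; _∨_; not; if_then_else_)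
import Data.Bool as B
open import Data.Bool.Properties using (∨-zeroʳ; ⇔→≡)
open import Data.Empty using (⊥-elim)
open import Data.Fin using (toℕ) renaming (_≟_ to _≟ᶠ_)
import Data.Fin as F
open import Data.Fin.Permutation as P using (_⟨$⟩ʳ_; _⟨$⟩ˡ_; _∘ₚ_; insert; remove; insert-remove)
  renaming (_≈_ to _≈ₚ_)
import Data.Fin.Properties as FP
open import Data.Fin.Subset using (_∉_; _⊆_; _∩_; _∪_; ⋃; ∣_∣; ∁; inside; outside)
open import Data.Fin.Subset.Properties
  using (_∈?_; _⊆?_; ⊆-antisym; ∉⊥; p⊆q⇒∣p∣≤∣q∣; p⊂q⇒∣p∣<∣q∣; x∈p∩q⁺; x∈p∩q⁻; x∈p∪q⁺; x∈p∪q⁻; x∉p⇒x∈∁p)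
open import Data.List using (List; []; _∷_; length; map; filter; foldr; concatMap; allFin; _++_)
open import Data.List.Extrema.Nat using (argmin; argmax; f[argmin]≤f[xs]; f[xs]≤f[argmax])
open import Data.List.Membership.Propositional using (find) renaming (_∈_ to _∈ᴸ_; _∉_ to _∉ᴸ_)
open import Data.List.Membership.Propositional.Properties
  using (∈-map⁺; ∈-map⁻; ∈-++⁺ˡ; ∈-++⁺ʳ; ∈-filter⁺; ∈-filter⁻; ∈-concatMap⁺; ∈-allFin)
open import Data.List.Properties using (map-tabulate; filter-notAll; length-++; length-map)
open import Data.List.Relation.Binary.Disjoint.Propositional using (Disjoint)
open import Data.List.Relation.Binary.Subset.Propositional using () renaming (_⊆_ to _⊆ᴸ_)
open import Data.List.Relation.Unary.All as All using (All; []; _∷_)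
open import Data.List.Relation.Unary.All.Properties using (¬All⇒Any¬)
open import Data.List.Relation.Unary.AllPairs using ([]; _∷_)
open import Data.List.Relation.Unary.Any as Any using (here; there)
open import Data.List.Relation.Unary.Unique.Propositional using (Unique)
import Data.List.Relation.Unary.Unique.Propositional.Properties as Unique
open import Data.Nat using (zero; suc; _+_; _*_; _<_; _⊔_; _⊓_; ∣_-_∣; z≤n; s≤s; s≤s⁻¹)
open import Data.Nat.Induction using (<-wellFounded)
open import Data.Nat.ListAction using (sum)
import Data.Nat.Properties as ℕ
open import Data.Product using (_,_; proj₁; proj₂)
open import Data.Sum using (_⊎_; inj₁; inj₂)
open import Data.Vec as V using (lookup)
open import Data.Vec.Properties using (∷-injectiveʳ; lookup∘tabulate; []=⇒lookup; lookup⇒[]=; ≡-dec)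
open import Function using (_∘_; id)
open import Function.Bundles using (mk⇔; Equivalence)
open import Induction.WellFounded using (Acc; acc)
open import Relation.Binary.Definitions using (DecidableEquality)
open import Relation.Binary.PropositionalEquality
  using (refl; sym; trans; cong; cong₂; subst; subst₂; _≢_; module ≡-Reasoning)
open import Relation.Nullary using (¬_; Dec; yes; no; does; contradiction)
open import Relation.Nullary.Decidable
  using (dec-true; dec-false; map′; _×-dec_; _⊎-dec_; _→-dec_; ¬?; decidable-stable)

module _ {A : Set} where

  ∈⇒≤-foldr-⊔ : (f : A → ℕ) {xs : List A} {x : A} → x ∈ᴸ xs → f x ≤ foldr _⊔_ 0 (map f xs)
  ∈⇒≤-foldr-⊔ f {y ∷ _} (here refl) = ℕ.m≤m⊔n (f y) _
  ∈⇒≤-foldr-⊔ f {y ∷ _} (there x∈) = ℕ.≤-trans (∈⇒≤-foldr-⊔ f x∈) (ℕ.m≤n⊔m (f y) _)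

  foldr-⊔-lub : (f : A → ℕ) (xs : List A) {k : ℕ} → (∀ {x} → x ∈ᴸ xs → f x ≤ k) → foldr _⊔_ 0 (map f xs) ≤ k
  foldr-⊔-lub f []       _ = z≤n
  foldr-⊔-lub f (x ∷ xs) h = ℕ.⊔-lub (h (here refl)) (foldr-⊔-lub f xs (h ∘ there))

  foldr-∧-true : (f : A → Bool) (xs : List A) → (∀ {x} → x ∈ᴸ xs → f x ≡ true) → foldr _∧_ true (map f xs) ≡ true
  foldr-∧-true f []       _ = refl
  foldr-∧-true f (x ∷ xs) h rewrite h (here refl) = foldr-∧-true f xs (h ∘ there)

  sum-map-mono : (f g : A → ℕ) (xs : List A) → (∀ {x} → x ∈ᴸ xs → f x ≤ g x) → sum (map f xs) ≤ sum (map g xs)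
  sum-map-mono f g []       _ = z≤n
  sum-map-mono f g (x ∷ xs) h = ℕ.+-mono-≤ (h (here refl)) (sum-map-mono f g xs (h ∘ there))

  Unique-⊆⇒length≤ : DecidableEquality A → {xs ys : List A} → Unique xs → xs ⊆ᴸ ys → length xs ≤ length ys
  Unique-⊆⇒length≤ _≟_ {[]}     _            _  = z≤n
  Unique-⊆⇒length≤ _≟_ {x ∷ xs} {ys} (x∉xs ∷ xs!) xs⊆ys = begin
    suc (length xs)                  ≤⟨ s≤s (Unique-⊆⇒length≤ _≟_ xs! xs⊆others) ⟩
    suc (length (filter (x ≢?_) ys)) ≤⟨ filter-notAll (x ≢?_) ys (Any.map (λ x≡y x≢y → x≢y x≡y) (xs⊆ys (here refl))) ⟩
    length ys                        ∎
    where
    open ℕ.≤-Reasoning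
    _≢?_ : (a b : A) → Dec (a ≢ b)
    a ≢? b = ¬? (a ≟ b)
    xs⊆others : xs ⊆ᴸ filter (x ≢?_) ys
    xs⊆others z∈xs = ∈-filter⁺ (x ≢?_) (xs⊆ys (there z∈xs)) (All.lookup x∉xs z∈xs)

  Count⇒Unique-sublist : {P : A → Set} {xs : List A} {m : ℕ} → Unique xs → Count P xs m →
    ∃ λ ys → Unique ys × All P ys × ys ⊆ᴸ xs × length ys ≡ m
  Count⇒Unique-sublist _ nil = [] , [] , [] , (λ ()) , refl
  Count⇒Unique-sublist (x∉xs ∷ xs!) (yes∷ px c) =
    let ys , ys! , pys , ys⊆xs , len = Count⇒Unique-sublist xs! c in
    _ ∷ ys , All.tabulate (λ y∈ys → All.lookup x∉xs (ys⊆xs y∈ys)) ∷ ys! , px ∷ pys ,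
    (λ { (here refl) → here refl ; (there y∈ys) → there (ys⊆xs y∈ys) }) , cong suc len
  Count⇒Unique-sublist (_ ∷ xs!) (no∷ _ c) =
    let ys , ys! , pys , ys⊆xs , len = Count⇒Unique-sublist xs! c in
    ys , ys! , pys , there ∘ ys⊆xs , len

module _ {n : ℕ} where

  x∈⋃⁺ : ∀ {Xs : List (Subset n)} {X x} → X ∈ᴸ Xs → x ∈ X → x ∈ ⋃ Xs
  x∈⋃⁺ {X ∷ _}  (here refl) x∈X = x∈p∪q⁺ (inj₁ x∈X)
  x∈⋃⁺ {Y ∷ _}  (there X∈)  x∈X = x∈p∪q⁺ {p = Y} (inj₂ (x∈⋃⁺ X∈ x∈X))

  x∈⋃⁻ : ∀ (Xs : List (Subset n)) {x} → x ∈ ⋃ Xs → ∃ λ X → X ∈ᴸ Xs × x ∈ X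
  x∈⋃⁻ []       x∈ = ⊥-elim (∉⊥ x∈)
  x∈⋃⁻ (X ∷ Xs) x∈ with x∈p∪q⁻ X (⋃ Xs) x∈
  ... | inj₁ x∈X = X , here refl , x∈X
  ... | inj₂ x∈⋃ = let Y , Y∈ , x∈Y = x∈⋃⁻ Xs x∈⋃ in Y , there Y∈ , x∈Y

  x∈tabulate-does⁺ : ∀ {P : Fin n → Set} (P? : ∀ x → Dec (P x)) {x} → P x → x ∈ V.tabulate (does ∘ P?)
  x∈tabulate-does⁺ P? {x} px = lookup⇒[]= x _ (trans (lookup∘tabulate (does ∘ P?) x) (dec-true (P? x) px))

  x∈tabulate-does⁻ : ∀ {P : Fin n → Set} (P? : ∀ x → Dec (P x)) {x} → x ∈ V.tabulate (does ∘ P?) → P x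
  x∈tabulate-does⁻ P? {x} x∈ with P? x | trans (sym (lookup∘tabulate (does ∘ P?) x)) ([]=⇒lookup x∈)
  ... | yes px | _ = px

  x∈tabulate⁺ : ∀ {f : Fin n → Bool} {x} → f x ≡ true → x ∈ V.tabulate f
  x∈tabulate⁺ {f} {x} fx = lookup⇒[]= x _ (trans (lookup∘tabulate f x) fx)

  x∈tabulate⁻ : ∀ {f : Fin n → Bool} {x} → x ∈ V.tabulate f → f x ≡ true
  x∈tabulate⁻ {f} {x} x∈ = trans (sym (lookup∘tabulate f x)) ([]=⇒lookup x∈)

  x∉p⇒lookup≡false : ∀ {p : Subset n} {x} → x ∉ p → lookup p x ≡ false
  x∉p⇒lookup≡false {p} {x} x∉p with lookup p x in eq
  ... | true  = contradiction (lookup⇒[]= x p eq) x∉p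
  ... | false = refl

  lookup≡false⇒x∉p : ∀ {p : Subset n} {x} → lookup p x ≡ false → x ∉ p
  lookup≡false⇒x∉p px x∈p with () ← trans (sym ([]=⇒lookup x∈p)) px


module _ {n : ℕ} {T : List (Fin n)} where

  -- Picking one vertex of T in each set gives distinct vertices, because sets sharing a vertex coincide.
  hitting⇒length< : ∀ {Ks : List (Subset n)} → Unique Ks →
    (∀ {X Y v} → X ∈ᴸ Ks → Y ∈ᴸ Ks → v ∈ X → v ∈ Y → X ≡ Y) →
    All (λ X → ∃ λ v → v ∈ X × v ∈ᴸ T) Ks →
    ∀ {t} → t ∈ᴸ T → (∀ {X} → X ∈ᴸ Ks → t ∉ X) → length Ks < length T
  hitting⇒length< Ks! overlap⇒≡ hits {t} t∈T t∉Ks =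
    let W , W! , W⊆T , len , W⊆Ks = witnesses Ks! overlap⇒≡ hits
        t∉W = All.tabulate λ w∈W t≡w → let X , X∈ , w∈X = All.lookup W⊆Ks w∈W in t∉Ks X∈ (subst (_∈ X) (sym t≡w) w∈X)
    in subst (λ k → suc k ≤ length T) len
         (Unique-⊆⇒length≤ _≟ᶠ_ {t ∷ W} (t∉W ∷ W!) λ { (here refl) → t∈T ; (there w∈W) → W⊆T w∈W })
    where
    witnesses : ∀ {Ks} → Unique Ks → (∀ {X Y v} → X ∈ᴸ Ks → Y ∈ᴸ Ks → v ∈ X → v ∈ Y → X ≡ Y) →
      All (λ X → ∃ λ v → v ∈ X × v ∈ᴸ T) Ks →
      ∃ λ W → Unique W × W ⊆ᴸ T × length W ≡ length Ks × All (λ w → ∃ λ X → X ∈ᴸ Ks × w ∈ X) W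
    witnesses []              _         []                    = [] , [] , (λ ()) , refl , []
    witnesses (X∉Ks ∷ Ks!) overlap⇒≡ ((v , v∈X , v∈T) ∷ hits) =
      let W , W! , W⊆T , len , W⊆Ks = witnesses Ks! (λ X∈ Y∈ → overlap⇒≡ (there X∈) (there Y∈)) hits in
      v ∷ W ,
      All.tabulate (λ w∈W v≡w → let Y , Y∈ , w∈Y = All.lookup W⊆Ks w∈W in
                     All.lookup X∉Ks Y∈ (overlap⇒≡ (here refl) (there Y∈) v∈X (subst (_∈ Y) (sym v≡w) w∈Y))) ∷ W! ,
      (λ { (here refl) → v∈T ; (there w∈W) → W⊆T w∈W }) ,
      cong suc len ,
      (_ , here refl , v∈X) ∷ All.map (λ (Y , Y∈ , w∈Y) → Y , there Y∈ , w∈Y) W⊆Ks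

∣p∣≡∣p∩q∣+∣p∩∁q∣ : ∀ {n} (p q : Subset n) → ∣ p ∣ ≡ ∣ p ∩ q ∣ + ∣ p ∩ ∁ q ∣
∣p∣≡∣p∩q∣+∣p∩∁q∣ V.[]             V.[]             = refl
∣p∣≡∣p∩q∣+∣p∩∁q∣ (inside  V.∷ p) (inside  V.∷ q) = cong suc (∣p∣≡∣p∩q∣+∣p∩∁q∣ p q)
∣p∣≡∣p∩q∣+∣p∩∁q∣ (inside  V.∷ p) (outside V.∷ q) = trans (cong suc (∣p∣≡∣p∩q∣+∣p∩∁q∣ p q)) (sym (ℕ.+-suc _ _))
∣p∣≡∣p∩q∣+∣p∩∁q∣ (outside V.∷ p) (_       V.∷ q) = ∣p∣≡∣p∩q∣+∣p∩∁q∣ p q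

∣p∣≡length-filter : ∀ {n} (p : Subset n) → ∣ p ∣ ≡ length (filter (_∈? p) (allFin n))
∣p∣≡length-filter V.[] = refl
∣p∣≡length-filter {suc n} (x V.∷ p) = begin
  ∣ x V.∷ p ∣                                                      ≡⟨ split-head x ⟩
  length (filter (_∈? (x V.∷ p)) (F.zero ∷ map F.suc (allFin n))) ≡⟨ cong (λ l → length (filter (_∈? (x V.∷ p)) (F.zero ∷ l)))
                                                                             (map-tabulate id F.suc) ⟩
  length (filter (_∈? (x V.∷ p)) (allFin (suc n)))                 ∎
  where
  open ≡-Reasoning
  filter-suc : ∀ {b} xs → length (filter (_∈? (b V.∷ p)) (map F.suc xs)) ≡ length (filter (_∈? p) xs)
  filter-suc []       = refl
  filter-suc (y ∷ ys) with y ∈? p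
  ... | yes _ = cong suc (filter-suc ys)
  ... | no  _ = filter-suc ys
  split-head : ∀ x → ∣ x V.∷ p ∣ ≡ length (filter (_∈? (x V.∷ p)) (F.zero ∷ map F.suc (allFin n)))
  split-head inside  = cong suc (trans (∣p∣≡length-filter p) (sym (filter-suc (allFin n))))
  split-head outside = trans (∣p∣≡length-filter p) (sym (filter-suc (allFin n)))

fibre : ∀ {n} {A : Set} → DecidableEquality A → (Fin n → A) → A → Subset n
fibre _≟_ f a = V.tabulate (λ v → does (f v ≟ a))

module _ {n : ℕ} {A : Set} (_≟_ : DecidableEquality A) (f : Fin n → A) where

  x∈fibre⁺ : ∀ {x a} → f x ≡ a → x ∈ fibre _≟_ f a
  x∈fibre⁺ {a = a} = x∈tabulate-does⁺ (λ v → f v ≟ a)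

  x∈fibre⁻ : ∀ {x a} → x ∈ fibre _≟_ f a → f x ≡ a
  x∈fibre⁻ {a = a} = x∈tabulate-does⁻ (λ v → f v ≟ a)

  sum-∣∩fibre∣≤ : ∀ {as : List A} → Unique as → ∀ X → sum (map (λ a → ∣ X ∩ fibre _≟_ f a ∣) as) ≤ ∣ X ∣
  sum-∣∩fibre∣≤ {[]}     _              X = z≤n
  sum-∣∩fibre∣≤ {a ∷ as} (a∉as ∷ as!) X = begin
    ∣ X ∩ F a ∣ + sum (map (λ b → ∣ X ∩ F b ∣) as)          ≤⟨ ℕ.+-monoʳ-≤ ∣ X ∩ F a ∣ (sum-map-mono _ _ as rest⊆) ⟩
    ∣ X ∩ F a ∣ + sum (map (λ b → ∣ (X ∩ ∁ (F a)) ∩ F b ∣) as) ≤⟨ ℕ.+-monoʳ-≤ ∣ X ∩ F a ∣ (sum-∣∩fibre∣≤ as! (X ∩ ∁ (F a))) ⟩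
    ∣ X ∩ F a ∣ + ∣ X ∩ ∁ (F a) ∣                              ≡⟨ sym (∣p∣≡∣p∩q∣+∣p∩∁q∣ X (F a)) ⟩
    ∣ X ∣                                                      ∎
    where
    open ℕ.≤-Reasoning
    F : A → Subset n
    F = fibre _≟_ f
    rest⊆ : ∀ {b} → b ∈ᴸ as → ∣ X ∩ F b ∣ ≤ ∣ (X ∩ ∁ (F a)) ∩ F b ∣
    rest⊆ b∈as = p⊆q⇒∣p∣≤∣q∣ λ x∈ →
      let x∈X , x∈Fb = x∈p∩q⁻ X (F _) x∈
          x∉Fa x∈Fa = All.lookup a∉as b∈as (trans (sym (x∈fibre⁻ x∈Fa)) (x∈fibre⁻ x∈Fb))
      in x∈p∩q⁺ (x∈p∩q⁺ (x∈X , x∉p⇒x∈∁p x∉Fa) , x∈Fb)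

module _ {n : ℕ} (G : Graph n) where

  ∈-allSubsets : ∀ {m} (N : Subset m) → N ∈ᴸ allSubsets G m
  ∈-allSubsets V.[]             = here refl
  ∈-allSubsets (inside  V.∷ N) = ∈-++⁺ˡ (∈-map⁺ (inside V.∷_) (∈-allSubsets N))
  ∈-allSubsets {suc m} (outside V.∷ N) =
    ∈-++⁺ʳ (map (inside V.∷_) (allSubsets G m)) (∈-map⁺ (outside V.∷_) (∈-allSubsets N))

  allSubsets-Unique : ∀ m → Unique (allSubsets G m)
  allSubsets-Unique zero    = [] ∷ []
  allSubsets-Unique (suc m) = Unique.++⁺ (prefix-Unique inside) (prefix-Unique outside) heads-differ
    where
    prefix-Unique : ∀ b → Unique (map (b V.∷_) (allSubsets G m))
    prefix-Unique _ = Unique.map⁺ ∷-injectiveʳ (allSubsets-Unique m)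
    heads-differ : ∀ {N} → ¬ (N ∈ᴸ map (inside V.∷_) (allSubsets G m) × N ∈ᴸ map (outside V.∷_) (allSubsets G m))
    heads-differ (N∈ᴵ , N∈ᴼ) with ∈-map⁻ (inside V.∷_) N∈ᴵ | ∈-map⁻ (outside V.∷_) N∈ᴼ
    ... | _ , _ , refl | _ , _ , ()

-- Orderings of minimum stretch

permutations : ∀ n → List (Permutation′ n)
permutations zero    = P.id ∷ []
permutations (suc n) = concatMap (λ j → map (insert F.zero j) (permutations n)) (allFin (suc n))

insert-cong : ∀ {n} (i j : Fin (suc n)) {π ρ : Permutation′ n} → π ≈ₚ ρ → insert i j π ≈ₚ insert i j ρ
insert-cong i j π≈ρ k with i ≟ᶠ k
... | yes _  = refl
... | no i≢k = cong (F.punchIn j) (π≈ρ (F.punchOut i≢k))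

∈-permutations : ∀ {n} (π : Permutation′ n) → ∃ λ τ → τ ∈ᴸ permutations n × τ ≈ₚ π
∈-permutations {zero}  π = P.id , here refl , λ ()
∈-permutations {suc n} π =
  let τ , τ∈ , τ≈ = ∈-permutations (remove F.zero π)
      j = π ⟨$⟩ʳ F.zero
  in insert F.zero j τ ,
     ∈-concatMap⁺ (λ j → map (insert F.zero j) (permutations n))
                  (Any.map (λ { refl → ∈-map⁺ (insert F.zero j) τ∈ }) (∈-allFin j)) ,
     λ k → trans (insert-cong F.zero j τ≈ k) (insert-remove F.zero π k)

minimising-permutation : ∀ {n} (f : Permutation′ n → ℕ) → (∀ {π ρ} → π ≈ₚ ρ → f π ≤ f ρ) → ∃ λ π → ∀ σ → f π ≤ f σ
minimising-permutation {n} f f-resp = argmin f P.id (permutations n) , λ σ →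
  let τ , τ∈ , τ≈σ = ∈-permutations σ
  in ℕ.≤-trans (All.lookup (f[argmin]≤f[xs] {f = f} P.id (permutations n)) τ∈) (f-resp τ≈σ)

module _ {n : ℕ} (G : Graph n) where
  open Graph G using (adj) renaming (sym to adj-sym; irrefl to adj-irrefl)

  Adj-sym : ∀ {u v} → Adj G u v → Adj G v u
  Adj-sym {u} {v} uv = trans (adj-sym v u) uv

  Adj-irrefl : ∀ {u v} → Adj G u v → u ≢ v
  Adj-irrefl {u} uu refl with () ← trans (sym uu) (adj-irrefl u)

  edge⇒≤stretch : ∀ π {u v} → Adj G u v → ∣ pos G π u - pos G π v ∣ ≤ stretch G π
  edge⇒≤stretch π {u} {v} uv = begin
    ∣ pos G π u - pos G π v ∣                 ≡⟨ cong (λ b → if b then ∣ pos G π u - pos G π v ∣ else 0) (sym uv) ⟩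
    distance u v                              ≤⟨ ∈⇒≤-foldr-⊔ (distance u) (∈-allFin v) ⟩
    foldr _⊔_ 0 (map (distance u) (allFin n)) ≤⟨ ∈⇒≤-foldr-⊔ (λ u → foldr _⊔_ 0 (map (distance u) (allFin n))) (∈-allFin u) ⟩
    stretch G π                               ∎
    where
    open ℕ.≤-Reasoning
    distance : Fin n → Fin n → ℕ
    distance u v = if adj u v then ∣ pos G π u - pos G π v ∣ else 0

  stretch≤ : ∀ π {k} → (∀ {u v} → Adj G u v → ∣ pos G π u - pos G π v ∣ ≤ k) → stretch G π ≤ k
  stretch≤ π {k} edge≤k = foldr-⊔-lub _ (allFin n) λ {u} _ → foldr-⊔-lub _ (allFin n) λ {v} _ → distance≤k u v
    where
    distance≤k : ∀ u v → (if adj u v then ∣ pos G π u - pos G π v ∣ else 0) ≤ k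
    distance≤k u v with adj u v in uv
    ... | true  = edge≤k uv
    ... | false = z≤n

  stretch-resp-≈ : ∀ {π ρ} → π ≈ₚ ρ → stretch G π ≤ stretch G ρ
  stretch-resp-≈ {π} {ρ} π≈ρ = stretch≤ π λ {u} {v} uv →
    subst (_≤ stretch G ρ) (cong₂ (λ x y → ∣ toℕ x - toℕ y ∣) (sym (π≈ρ u)) (sym (π≈ρ v))) (edge⇒≤stretch ρ uv)

  bandwidth-ordering : ∃ (HasBandwidthStretch G)
  bandwidth-ordering = minimising-permutation (stretch G) λ {π} {ρ} → stretch-resp-≈ {π} {ρ}

  pos-injective : ∀ π {x y} → pos G π x ≡ pos G π y → x ≡ y
  pos-injective π {x} {y} πx≡πy = begin
    x                          ≡⟨ sym (P.inverseˡ π) ⟩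
    π ⟨$⟩ˡ (π ⟨$⟩ʳ x)          ≡⟨ cong (π ⟨$⟩ˡ_) (FP.toℕ-injective πx≡πy) ⟩
    π ⟨$⟩ˡ (π ⟨$⟩ʳ y)          ≡⟨ P.inverseˡ π ⟩
    y                          ∎
    where open ≡-Reasoning

  record InvolutiveAutomorphism : Set where
    field
      apply         : Fin n → Fin n
      involutive    : ∀ v → apply (apply v) ≡ v
      adj-preserved : ∀ u v → adj (apply u) (apply v) ≡ adj u v

  module _ (σ : InvolutiveAutomorphism) where
    open InvolutiveAutomorphism σ

    reorder : Permutation′ n → Permutation′ n
    reorder π = P.permutation apply apply involutive involutive ∘ₚ π

    reorder-bandwidth : ∀ {π} → HasBandwidthStretch G π → HasBandwidthStretch G (reorder π)
    reorder-bandwidth {π} optimal ρ = ℕ.≤-trans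
      (stretch≤ (reorder π) λ {u} {v} uv → edge⇒≤stretch π (trans (adj-preserved u v) uv))
      (optimal ρ)

-- Extreme neighbours

data Side : Set where
  left right : Side

Precedes : Side → ℕ → ℕ → Set
Precedes left  a b = a ≤ b
Precedes right a b = b ≤ a

module _ {n : ℕ} (G : Graph n) where
  open Graph G using (adj)

  IsExtremeNeighbour : Side → (Fin n → ℕ) → Fin n → Fin n → Set
  IsExtremeNeighbour side p s x = Adj G s x × (∀ u → Adj G s u → Precedes side (p x) (p u))

  -- Non-neighbours get a key that loses against every neighbour; for the leftmost one this needs p < n.
  extremeNeighbour : Side → (Fin n → ℕ) → Fin n → Fin n
  extremeNeighbour left  p s = argmin (λ v → if adj s v then p v else n) s (allFin n)
  extremeNeighbour right p s = argmax (λ v → if adj s v then suc (p v) else 0) s (allFin n)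

  extremeNeighbour-isExtreme : ∀ side {p s u} → (∀ v → p v < n) → Adj G s u →
                               IsExtremeNeighbour side p s (extremeNeighbour side p s)
  extremeNeighbour-isExtreme left {p} {s} {u₀} p<n su₀ = s~x , λ u su → subst₂ _≤_ (key-adj s~x) (key-adj su) (x≤ u)
    where
    key : Fin n → ℕ
    key v = if adj s v then p v else n
    x = extremeNeighbour left p s
    key-adj : ∀ {v} → Adj G s v → key v ≡ p v
    key-adj sv = cong (λ b → if b then p _ else n) sv
    x≤ : ∀ u → key x ≤ key u
    x≤ u = All.lookup (f[argmin]≤f[xs] {f = key} s (allFin n)) (∈-allFin u)
    s~x : Adj G s x
    s~x with adj s x in sx
    ... | true  = refl
    ... | false = contradiction (subst (_≤ key u₀) (cong (λ b → if b then p x else n) sx) (x≤ u₀))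
                                (ℕ.<⇒≱ (subst (_< n) (sym (key-adj su₀)) (p<n u₀)))
  extremeNeighbour-isExtreme right {p} {s} {u₀} _ su₀ = s~x , λ u su → s≤s⁻¹ (subst₂ _≤_ (key-adj su) (key-adj s~x) (≤x u))
    where
    key : Fin n → ℕ
    key v = if adj s v then suc (p v) else 0
    x = extremeNeighbour right p s
    key-adj : ∀ {v} → Adj G s v → key v ≡ suc (p v)
    key-adj sv = cong (λ b → if b then suc (p _) else 0) sv
    ≤x : ∀ u → key u ≤ key x
    ≤x u = All.lookup (f[xs]≤f[argmax] {f = key} s (allFin n)) (∈-allFin u)
    s~x : Adj G s x
    s~x with adj s x in sx
    ... | true  = refl
    ... | false = contradiction (subst (key u₀ ≤_) (cong (λ b → if b then suc (p x) else 0) sx) (≤x u₀))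
                                (ℕ.<⇒≱ (subst (0 <_) (sym (key-adj su₀)) (s≤s z≤n)))

  isExtremeNeighbour-unique : ∀ side {p s x y} → (∀ {x y} → p x ≡ p y → x ≡ y) →
    IsExtremeNeighbour side p s x → IsExtremeNeighbour side p s y → x ≡ y
  isExtremeNeighbour-unique left  p-inj (sx , x≤) (sy , y≤) = p-inj (ℕ.≤-antisym (x≤ _ sy) (y≤ _ sx))
  isExtremeNeighbour-unique right p-inj (sx , x≥) (sy , y≥) = p-inj (ℕ.≤-antisym (y≥ _ sx) (x≥ _ sy))

  isExtremeNeighbour? : ∀ side p s x → Dec (IsExtremeNeighbour side p s x)
  isExtremeNeighbour? side p s x = (adj s x B.≟ true) ×-dec FP.all? λ u → (adj s u B.≟ true) →-dec precedes? side
    where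
    precedes? : ∀ side {a b} → Dec (Precedes side a b)
    precedes? left  = _ ℕ.≤? _
    precedes? right = _ ℕ.≤? _

  module _ (σ : InvolutiveAutomorphism G) where
    open InvolutiveAutomorphism σ

    Adj-preserved : ∀ {s u} → apply s ≡ s → Adj G s u → Adj G s (apply u)
    Adj-preserved {s} {u} σs≡s su = trans (cong (λ t → adj t (apply u)) (sym σs≡s)) (trans (adj-preserved s u) su)

    isExtremeNeighbour-apply : ∀ side {p s x} → apply s ≡ s →
      IsExtremeNeighbour side p s x → IsExtremeNeighbour side (p ∘ apply) s (apply x)
    isExtremeNeighbour-apply side {p} σs≡s (sx , x-first) =
      Adj-preserved σs≡s sx ,
      λ u su → subst (λ y → Precedes side (p y) (p (apply u))) (sym (involutive _))
                     (x-first (apply u) (Adj-preserved σs≡s su))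

-- Clusters and cluster types

module Clusters {n : ℕ} (G : Graph n) (S : Subset n) (cds : IsClusterDeletionSet G S) where
  open Graph G using (adj) renaming (irrefl to adj-irrefl)

  SameOrAdj : Fin n → Fin n → Set
  SameOrAdj u v = u ≡ v ⊎ Adj G u v

  SameOrAdj-sym : ∀ {u v} → SameOrAdj u v → SameOrAdj v u
  SameOrAdj-sym (inj₁ refl) = inj₁ refl
  SameOrAdj-sym (inj₂ uv)   = inj₂ (Adj-sym G uv)

  Reach⇒∉ : ∀ {u v} → Reach G S u v → v ∉ S
  Reach⇒∉ (here v∉S)     = v∉S
  Reach⇒∉ (step _ v∉S _) = v∉S

  Reach-extend : ∀ {u v w} → Reach G S u v → w ∉ S → SameOrAdj v w → Reach G S u w
  Reach-extend r _    (inj₁ refl) = r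
  Reach-extend r w∉S (inj₂ vw)   = step r w∉S vw

  SameOrAdj⇒Reach : ∀ {u v} → u ∉ S → v ∉ S → SameOrAdj u v → Reach G S u v
  SameOrAdj⇒Reach u∉S = Reach-extend (here u∉S)

  -- Transitivity is where the cluster deletion set is used: a path in G - S is a single edge.
  SameOrAdj-trans : ∀ {u v w} → u ∉ S → v ∉ S → w ∉ S → SameOrAdj u v → SameOrAdj v w → SameOrAdj u w
  SameOrAdj-trans u∉S v∉S w∉S uv vw = cds _ _ (Reach-extend (SameOrAdj⇒Reach u∉S v∉S uv) w∉S vw)

  clusterOf : Fin n → Subset n
  clusterOf r = V.tabulate λ v → not (lookup S v) ∧ (does (v ≟ᶠ r) ∨ adj r v)

  ∈clusterOf⁺ : ∀ {r v} → v ∉ S → SameOrAdj r v → v ∈ clusterOf r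
  ∈clusterOf⁺ {r} {v} v∉S r~v = x∈tabulate⁺ (member r~v)
    where
    member : SameOrAdj r v → not (lookup S v) ∧ (does (v ≟ᶠ r) ∨ adj r v) ≡ true
    member (inj₁ refl) rewrite x∉p⇒lookup≡false v∉S | dec-true (v ≟ᶠ v) refl = refl
    member (inj₂ rv)   rewrite x∉p⇒lookup≡false v∉S | rv = ∨-zeroʳ _

  ∈clusterOf⁻ : ∀ {r v} → v ∈ clusterOf r → v ∉ S × SameOrAdj r v
  ∈clusterOf⁻ {r} {v} v∈ = member (x∈tabulate⁻ v∈)
    where
    member : not (lookup S v) ∧ (does (v ≟ᶠ r) ∨ adj r v) ≡ true → v ∉ S × SameOrAdj r v
    member eq with lookup S v in Sv | v ≟ᶠ r | adj r v
    member _  | false | yes v≡r | _     = lookup≡false⇒x∉p Sv , inj₁ (sym v≡r)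
    member _  | false | no _    | true  = lookup≡false⇒x∉p Sv , inj₂ refl
    member () | false | no _    | false
    member () | true  | _       | _

  r∈clusterOf : ∀ {r} → r ∉ S → r ∈ clusterOf r
  r∈clusterOf r∉S = ∈clusterOf⁺ r∉S (inj₁ refl)

  clusterOf-isCluster : ∀ {r} → r ∉ S → IsCluster G S (clusterOf r)
  clusterOf-isCluster r∉S = _ , r∉S , λ v → mk⇔
    (λ v∈ → let v∉S , r~v = ∈clusterOf⁻ v∈ in SameOrAdj⇒Reach r∉S v∉S r~v)
    (λ r⇝v → ∈clusterOf⁺ (Reach⇒∉ r⇝v) (cds _ _ r⇝v))

  isCluster⇒≡clusterOf : ∀ {X} → (c : IsCluster G S X) → X ≡ clusterOf (proj₁ c)
  isCluster⇒≡clusterOf (r , r∉S , X⇔) = ⊆-antisym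
    (λ v∈X → let r⇝v = Equivalence.to (X⇔ _) v∈X in ∈clusterOf⁺ (Reach⇒∉ r⇝v) (cds _ _ r⇝v))
    (λ v∈ → let v∉S , r~v = ∈clusterOf⁻ v∈ in Equivalence.from (X⇔ _) (SameOrAdj⇒Reach r∉S v∉S r~v))

  ∈clusterOf⇒clusterOf≡ : ∀ {r u} → r ∉ S → u ∈ clusterOf r → clusterOf u ≡ clusterOf r
  ∈clusterOf⇒clusterOf≡ r∉S u∈ =
    let u∉S , r~u = ∈clusterOf⁻ u∈ in ⊆-antisym
      (λ v∈ → let v∉S , u~v = ∈clusterOf⁻ v∈ in ∈clusterOf⁺ v∉S (SameOrAdj-trans r∉S u∉S v∉S r~u u~v))
      (λ v∈ → let v∉S , r~v = ∈clusterOf⁻ v∈ in ∈clusterOf⁺ v∉S (SameOrAdj-trans u∉S r∉S v∉S (SameOrAdj-sym r~u) r~v))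

  isCluster-∋⇒≡clusterOf : ∀ {X u} → IsCluster G S X → u ∈ X → X ≡ clusterOf u
  isCluster-∋⇒≡clusterOf c@(_ , r∉S , _) u∈X = trans X≡ (sym (∈clusterOf⇒clusterOf≡ r∉S (subst (_ ∈_) X≡ u∈X)))
    where X≡ = isCluster⇒≡clusterOf c

  overlapping-clusters-≡ : ∀ {X Y u} → IsCluster G S X → IsCluster G S Y → u ∈ X → u ∈ Y → X ≡ Y
  overlapping-clusters-≡ cX cY u∈X u∈Y = trans (isCluster-∋⇒≡clusterOf cX u∈X) (sym (isCluster-∋⇒≡clusterOf cY u∈Y))

  clusterOf-adj : ∀ {r u v} → r ∉ S → u ∈ clusterOf r → v ∈ clusterOf r → u ≢ v → Adj G u v
  clusterOf-adj r∉S u∈ v∈ u≢v with ∈clusterOf⁻ u∈ | ∈clusterOf⁻ v∈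
  ... | u∉S , r~u | v∉S , r~v with SameOrAdj-trans u∉S r∉S v∉S (SameOrAdj-sym r~u) r~v
  ...   | inj₁ u≡v = contradiction u≡v u≢v
  ...   | inj₂ uv  = uv

  clusterOf-closed : ∀ {r u v} → r ∉ S → u ∈ clusterOf r → v ∉ S → Adj G u v → v ∈ clusterOf r
  clusterOf-closed r∉S u∈ v∉S uv = let u∉S , r~u = ∈clusterOf⁻ u∈ in ∈clusterOf⁺ v∉S (SameOrAdj-trans r∉S u∉S v∉S r~u (inj₂ uv))

  NS⊆S : ∀ v → NS G S v ⊆ S
  NS⊆S v {s} s∈ = lookup⇒[]= s S (∧-true-left (x∈tabulate⁻ s∈))
    where
    ∧-true-left : ∀ {a b} → a ∧ b ≡ true → a ≡ true
    ∧-true-left {true} _ = refl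

  clusterOf-isClique : ∀ {r} → r ∉ S → isClique G (clusterOf r) ≡ true
  clusterOf-isClique {r} r∉S = foldr-∧-true _ (allFin n) λ {u} _ → foldr-∧-true _ (allFin n) λ {v} _ → pair-ok u v
    where
    C = clusterOf r
    pair-ok : ∀ u v → (if lookup C u ∧ lookup C v ∧ not (does (u ≟ᶠ v)) then adj u v else true) ≡ true
    pair-ok u v with lookup C u in Cu | lookup C v in Cv | u ≟ᶠ v
    ... | true  | true  | no u≢v = clusterOf-adj r∉S (lookup⇒[]= u C Cu) (lookup⇒[]= v C Cv) u≢v
    ... | true  | true  | yes _  = refl
    ... | true  | false | _      = refl
    ... | false | _     | _      = refl

  ∣clusterOf∣≤ω : ∀ {r} → r ∉ S → ∣ clusterOf r ∣ ≤ ω G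
  ∣clusterOf∣≤ω {r} r∉S =
    ∈⇒≤-foldr-⊔ ∣_∣ (∈-filter⁺ (λ C → isClique G C B.≟ true) (∈-allSubsets G (clusterOf r)) (clusterOf-isClique r∉S))

  clusterOf-type∈K : ∀ {r} → r ∉ S → InK G S (typeCount G S (clusterOf r))
  clusterOf-type∈K r∉S = ℕ.≤-trans
    (sum-∣∩fibre∣≤ (≡-dec B._≟_) (NS G S) (Unique.filter⁺ (_⊆? S) (allSubsets-Unique G n)) (clusterOf _))
    (∣clusterOf∣≤ω r∉S)

  isCluster? : ∀ X → Dec (IsCluster G S X)
  isCluster? X = map′ from-root to-root (FP.any? λ r → ¬? (r ∈? S) ×-dec ≡-dec B._≟_ X (clusterOf r))
    where
    from-root : (∃ λ r → r ∉ S × X ≡ clusterOf r) → IsCluster G S X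
    from-root (r , r∉S , refl) = clusterOf-isCluster r∉S
    to-root : IsCluster G S X → ∃ λ r → r ∉ S × X ≡ clusterOf r
    to-root c@(r , r∉S , _) = r , r∉S , isCluster⇒≡clusterOf c

  hasType? : ∀ κ X → Dec (HasType G S κ X)
  hasType? κ X = map′ (λ all N N⊆S → All.lookup all (∈-allSubsets G N) N⊆S) (λ h → All.tabulate λ {N} _ → h N)
                      (All.all? (λ N → (N ⊆? S) →-dec (typeCount G S X N ℕ.≟ κ N)) (allSubsets G n))

  clustersOfType : ClusterTypeVec G → List (Subset n)
  clustersOfType κ = filter (λ X → isCluster? X ×-dec hasType? κ X) (allSubsets G n)

  ∈clustersOfType⁺ : ∀ {κ X} → IsCluster G S X → HasType G S κ X → X ∈ᴸ clustersOfType κ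
  ∈clustersOfType⁺ {κ} {X} cX tX = ∈-filter⁺ (λ X → isCluster? X ×-dec hasType? κ X) (∈-allSubsets G X) (cX , tX)

  clustersOfType-count : ∀ κ → NumClusters G S κ (length (clustersOfType κ))
  clustersOfType-count κ = clustersOfType κ , Unique.filter⁺ ofType? (allSubsets-Unique G n) ,
    (λ X → mk⇔ (proj₂ ∘ ∈-filter⁻ ofType? {xs = allSubsets G n}) λ (cX , tX) → ∈clustersOfType⁺ cX tX) , refl
    where ofType? = λ X → isCluster? X ×-dec hasType? κ X

-- Exchanging two clusters of the same type

module ListSwap {A : Set} (_≟_ : DecidableEquality A) where

  swap : List A → List A → A → A
  swap (x ∷ xs) (y ∷ ys) v = if does (v ≟ x) then y else if does (v ≟ y) then x else swap xs ys v
  swap _        _        v = v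

  swap-headˡ : ∀ x xs y ys → swap (x ∷ xs) (y ∷ ys) x ≡ y
  swap-headˡ x xs y ys rewrite dec-true (x ≟ x) refl = refl

  swap-headʳ : ∀ x xs y ys → x ≢ y → swap (x ∷ xs) (y ∷ ys) y ≡ x
  swap-headʳ x xs y ys x≢y rewrite dec-false (y ≟ x) (x≢y ∘ sym) | dec-true (y ≟ y) refl = refl

  swap-tail : ∀ x xs y ys v → v ≢ x → v ≢ y → swap (x ∷ xs) (y ∷ ys) v ≡ swap xs ys v
  swap-tail x xs y ys v v≢x v≢y rewrite dec-false (v ≟ x) v≢x | dec-false (v ≟ y) v≢y = refl

  swap-outside : ∀ xs ys {v} → v ∉ᴸ xs → v ∉ᴸ ys → swap xs ys v ≡ v
  swap-outside (x ∷ xs) (y ∷ ys) v∉xs v∉ys =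
    trans (swap-tail x xs y ys _ (v∉xs ∘ here) (v∉ys ∘ here)) (swap-outside xs ys (v∉xs ∘ there) (v∉ys ∘ there))
  swap-outside []       _        _ _ = refl
  swap-outside (_ ∷ _)  []       _ _ = refl

  swap-∈ˡ : ∀ {xs ys} → Unique xs → Disjoint xs ys → length xs ≡ length ys → ∀ {v} → v ∈ᴸ xs → swap xs ys v ∈ᴸ ys
  swap-∈ˡ {x ∷ xs} {y ∷ ys} _            _  _   (here refl) = subst (_∈ᴸ y ∷ ys) (sym (swap-headˡ x xs y ys)) (here refl)
  swap-∈ˡ {x ∷ xs} {y ∷ ys} (x∉xs ∷ xs!) xs#ys len {v} (there v∈xs) =
    subst (_∈ᴸ y ∷ ys) (sym (swap-tail x xs y ys v (All.lookup x∉xs v∈xs ∘ sym) λ v≡y → xs#ys (there v∈xs , here v≡y)))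
      (there (swap-∈ˡ xs! (λ (a , b) → xs#ys (there a , there b)) (ℕ.suc-injective len) v∈xs))

  swap-∈ʳ : ∀ {xs ys} → Unique ys → Disjoint xs ys → length xs ≡ length ys → ∀ {v} → v ∈ᴸ ys → swap xs ys v ∈ᴸ xs
  swap-∈ʳ {x ∷ xs} {y ∷ ys} _            xs#ys _ (here refl) =
    subst (_∈ᴸ x ∷ xs) (sym (swap-headʳ x xs y ys λ x≡y → xs#ys (here refl , here x≡y))) (here refl)
  swap-∈ʳ {x ∷ xs} {y ∷ ys} (y∉ys ∷ ys!) xs#ys len {v} (there v∈ys) =
    subst (_∈ᴸ x ∷ xs) (sym (swap-tail x xs y ys v (λ v≡x → xs#ys (here v≡x , there v∈ys)) (All.lookup y∉ys v∈ys ∘ sym)))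
      (there (swap-∈ʳ ys! (λ (a , b) → xs#ys (there a , there b)) (ℕ.suc-injective len) v∈ys))

  -- If the tail swap sent v to the head x, then, x lying outside both tails, v = swap (swap v) = swap x = x.
  swap-involutive : ∀ {xs ys} → Unique xs → Unique ys → Disjoint xs ys → ∀ v → swap xs ys (swap xs ys v) ≡ v
  swap-involutive {x ∷ xs} {y ∷ ys} (x∉xs ∷ xs!) (y∉ys ∷ ys!) xs#ys v with v ≟ x | v ≟ y
  ... | yes refl | _        = swap-headʳ x xs y ys λ x≡y → xs#ys (here refl , here x≡y)
  ... | no _     | yes refl = swap-headˡ x xs y ys
  ... | no v≢x   | no v≢y   = trans (swap-tail x xs y ys w w≢x w≢y) tail-involutive
    where
    tail-involutive = swap-involutive xs! ys! (λ (a , b) → xs#ys (there a , there b)) v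
    w = swap xs ys v
    x∉ys : x ∉ᴸ ys
    x∉ys x∈ys = xs#ys (here refl , there x∈ys)
    y∉xs : y ∉ᴸ xs
    y∉xs y∈xs = xs#ys (there y∈xs , here refl)
    w≢x : w ≢ x
    w≢x refl = v≢x (trans (sym tail-involutive) (swap-outside xs ys (λ x∈xs → All.lookup x∉xs x∈xs refl) x∉ys))
    w≢y : w ≢ y
    w≢y refl = v≢y (trans (sym tail-involutive) (swap-outside xs ys y∉xs (λ y∈ys → All.lookup y∉ys y∈ys refl)))
  swap-involutive {[]}    _ _ _ v = refl
  swap-involutive {_ ∷ _} {[]} _ _ _ v = refl

module ClusterSwap {n : ℕ} (G : Graph n) (S : Subset n) (cds : IsClusterDeletionSet G S)
  {c d : Fin n} (c∉S : c ∉ S) (d∉S : d ∉ S)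
  (C#D : ∀ {v} → v ∈ Clusters.clusterOf G S cds c → v ∉ Clusters.clusterOf G S cds d)
  (same-type : ∀ N → N ⊆ S → typeCount G S (Clusters.clusterOf G S cds c) N ≡ typeCount G S (Clusters.clusterOf G S cds d) N)
  where
  open Graph G using (adj)
  open Clusters G S cds
  open ListSwap (_≟ᶠ_ {n})

  C D : Subset n
  C = clusterOf c
  D = clusterOf d

  TypeClass : Subset n → Subset n
  TypeClass = fibre (≡-dec B._≟_) (NS G S)

  members : Subset n → Subset n → List (Fin n)
  members X N = filter (_∈? (X ∩ TypeClass N)) (allFin n)

  ∈members⁺ : ∀ {X v} → v ∈ X → v ∈ᴸ members X (NS G S v)
  ∈members⁺ {X} {v} v∈X = ∈-filter⁺ (_∈? (X ∩ TypeClass _)) (∈-allFin v) (x∈p∩q⁺ (v∈X , x∈fibre⁺ (≡-dec B._≟_) (NS G S) refl))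

  ∈members⁻ : ∀ {X N v} → v ∈ᴸ members X N → v ∈ X × NS G S v ≡ N
  ∈members⁻ {X} {N} v∈ =
    let v∈X , v∈N = x∈p∩q⁻ X (TypeClass N) (proj₂ (∈-filter⁻ (_∈? (X ∩ TypeClass N)) {xs = allFin n} v∈))
    in v∈X , x∈fibre⁻ (≡-dec B._≟_) (NS G S) v∈N

  members-Unique : ∀ X N → Unique (members X N)
  members-Unique X N = Unique.filter⁺ (_∈? (X ∩ TypeClass N)) (Unique.allFin⁺ n)

  members-disjoint : ∀ N → Disjoint (members C N) (members D N)
  members-disjoint N (v∈C , v∈D) = C#D (proj₁ (∈members⁻ v∈C)) (proj₁ (∈members⁻ v∈D))

  members-length : ∀ N → N ⊆ S → length (members C N) ≡ length (members D N)
  members-length N N⊆S = begin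
    length (members C N)  ≡⟨ sym (∣p∣≡length-filter (C ∩ TypeClass N)) ⟩
    typeCount G S C N     ≡⟨ same-type N N⊆S ⟩
    typeCount G S D N     ≡⟨ ∣p∣≡length-filter (D ∩ TypeClass N) ⟩
    length (members D N)  ∎
    where open ≡-Reasoning

  -- C and D have the same type, so for each N ⊆ S their vertices with N_S = N can be paired off.
  σ : Fin n → Fin n
  σ v = swap (members C (NS G S v)) (members D (NS G S v)) v

  σ-∈C : ∀ {v} → v ∈ C → σ v ∈ D × NS G S (σ v) ≡ NS G S v
  σ-∈C {v} v∈C = ∈members⁻ (swap-∈ˡ (members-Unique C _) (members-disjoint _) (members-length _ (NS⊆S v)) (∈members⁺ v∈C))

  σ-∈D : ∀ {v} → v ∈ D → σ v ∈ C × NS G S (σ v) ≡ NS G S v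
  σ-∈D {v} v∈D = ∈members⁻ (swap-∈ʳ (members-Unique D _) (members-disjoint _) (members-length _ (NS⊆S v)) (∈members⁺ v∈D))

  σ-fix : ∀ {v} → v ∉ C → v ∉ D → σ v ≡ v
  σ-fix v∉C v∉D = swap-outside _ _ (v∉C ∘ proj₁ ∘ ∈members⁻) (v∉D ∘ proj₁ ∘ ∈members⁻)

  σ-fixes-S : ∀ {s} → s ∈ S → σ s ≡ s
  σ-fixes-S s∈S = σ-fix (λ s∈C → proj₁ (∈clusterOf⁻ s∈C) s∈S) (λ s∈D → proj₁ (∈clusterOf⁻ s∈D) s∈S)

  NS-σ : ∀ v → NS G S (σ v) ≡ NS G S v
  NS-σ v with v ∈? C | v ∈? D
  ... | yes v∈C | _       = proj₂ (σ-∈C v∈C)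
  ... | no _    | yes v∈D = proj₂ (σ-∈D v∈D)
  ... | no v∉C  | no v∉D  = cong (NS G S) (σ-fix v∉C v∉D)

  σ-involutive : ∀ v → σ (σ v) ≡ v
  σ-involutive v = trans (cong (λ N → swap (members C N) (members D N) (σ v)) (NS-σ v))
                         (swap-involutive (members-Unique C _) (members-Unique D _) (members-disjoint _) v)

  σ-injective : ∀ {u v} → σ u ≡ σ v → u ≡ v
  σ-injective {u} {v} σu≡σv = trans (sym (σ-involutive u)) (trans (cong σ σu≡σv) (σ-involutive v))

  adj-σ-S : ∀ {s} → s ∈ S → ∀ u → adj (σ u) s ≡ adj u s
  adj-σ-S {s} s∈S u = trans (sym (lookup-NS (σ u))) (trans (cong (λ N → lookup N s) (NS-σ u)) (lookup-NS u))
    where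
    lookup-NS : ∀ w → lookup (NS G S w) s ≡ adj w s
    lookup-NS w = trans (lookup∘tabulate (λ s → lookup S s ∧ adj w s) s) (cong (_∧ adj w s) ([]=⇒lookup s∈S))

  σ-preserves-Adj : ∀ {u v} → Adj G u v → Adj G (σ u) (σ v)
  σ-preserves-Adj {u} {v} uv with u ∈? S | v ∈? S
  ... | yes u∈S | _ rewrite σ-fixes-S u∈S = Adj-sym G (trans (adj-σ-S u∈S v) (Adj-sym G uv))
  ... | no _ | yes v∈S rewrite σ-fixes-S v∈S = trans (adj-σ-S v∈S u) uv
  ... | no u∉S | no v∉S with u ∈? C | u ∈? D
  ...   | yes u∈C | _ =
    clusterOf-adj d∉S (proj₁ (σ-∈C u∈C)) (proj₁ (σ-∈C (clusterOf-closed c∉S u∈C v∉S uv))) (Adj-irrefl G uv ∘ σ-injective)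
  ...   | no _ | yes u∈D =
    clusterOf-adj c∉S (proj₁ (σ-∈D u∈D)) (proj₁ (σ-∈D (clusterOf-closed d∉S u∈D v∉S uv))) (Adj-irrefl G uv ∘ σ-injective)
  ...   | no u∉C | no u∉D rewrite σ-fix u∉C u∉D
                           | σ-fix (u∉C ∘ λ v∈C → clusterOf-closed c∉S v∈C u∉S (Adj-sym G uv))
                                   (u∉D ∘ λ v∈D → clusterOf-closed d∉S v∈D u∉S (Adj-sym G uv)) = uv

  swapClusters : InvolutiveAutomorphism G
  swapClusters = record
    { apply         = σ
    ; involutive    = σ-involutive
    ; adj-preserved = λ u v → ⇔→≡ (mk⇔ (λ σuσv → subst₂ (Adj G) (σ-involutive u) (σ-involutive v) (σ-preserves-Adj σuσv))
                                         σ-preserves-Adj)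
    }

-- The exchange argument

module Exchange {n : ℕ} (G : Graph n) (S : Subset n) (cds : IsClusterDeletionSet G S)
  (𝒞 : List (Subset n)) (𝒞! : Unique 𝒞) (𝒞-clusters : All (IsCluster G S) 𝒞)
  (𝒞-count : ∀ κ → InK G S κ → ∀ m → NumClusters G S κ m → Count (HasType G S κ) 𝒞 (2 * ∣ S ∣ ⊓ m)) where
  open Clusters G S cds

  S' : Subset n
  S' = S ∪ ⋃ 𝒞

  ∈𝒞⇒∈S' : ∀ {X v} → X ∈ᴸ 𝒞 → v ∈ X → v ∈ S'
  ∈𝒞⇒∈S' X∈𝒞 v∈X = x∈p∪q⁺ {p = S} (inj₂ (x∈⋃⁺ X∈𝒞 v∈X))

  ∉S'⇒∉S : ∀ {x} → x ∉ S' → x ∉ S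
  ∉S'⇒∉S x∉S' x∈S = x∉S' (x∈p∪q⁺ (inj₁ x∈S))

  ∉S'⇒clusterOf∉𝒞 : ∀ {x} → x ∉ S' → clusterOf x ∉ᴸ 𝒞
  ∉S'⇒clusterOf∉𝒞 x∉S' C∈𝒞 = x∉S' (∈𝒞⇒∈S' C∈𝒞 (r∈clusterOf (∉S'⇒∉S x∉S')))

  ∉S'⇒clusterOf∩S'≡∅ : ∀ {x v} → x ∉ S' → v ∈ clusterOf x → v ∉ S'
  ∉S'⇒clusterOf∩S'≡∅ {x} x∉S' v∈C v∈S' with x∈p∪q⁻ S (⋃ 𝒞) v∈S'
  ... | inj₁ v∈S  = proj₁ (∈clusterOf⁻ v∈C) v∈S
  ... | inj₂ v∈⋃ = let X , X∈𝒞 , v∈X = x∈⋃⁻ 𝒞 v∈⋃ in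
    ∉S'⇒clusterOf∉𝒞 x∉S' (subst (_∈ᴸ 𝒞) (trans (isCluster-∋⇒≡clusterOf (All.lookup 𝒞-clusters X∈𝒞) v∈X)
                                                (∈clusterOf⇒clusterOf≡ (∉S'⇒∉S x∉S') v∈C)) X∈𝒞)

  -- A type-κ cluster outside 𝒞 shows #κ > min(2|S|, #κ), so 𝒞 contains 2|S| clusters of type κ.
  𝒞-saturates-type : ∀ {x} → x ∉ S' → ∃ λ Ds → Unique Ds × All (HasType G S (typeCount G S (clusterOf x))) Ds ×
                                        Ds ⊆ᴸ 𝒞 × length Ds ≡ 2 * ∣ S ∣
  𝒞-saturates-type {x} x∉S' =
    let Ds , Ds! , Ds-type , Ds⊆𝒞 , len =
          Count⇒Unique-sublist 𝒞! (𝒞-count κ (clusterOf-type∈K x∉S) _ (clustersOfType-count κ))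
        C∷Ds! = All.tabulate (λ D∈Ds C≡D → ∉S'⇒clusterOf∉𝒞 x∉S' (subst (_∈ᴸ 𝒞) (sym C≡D) (Ds⊆𝒞 D∈Ds))) ∷ Ds!
        C∷Ds⊆ : clusterOf x ∷ Ds ⊆ᴸ clustersOfType κ
        C∷Ds⊆ = λ { (here refl)  → ∈clustersOfType⁺ (clusterOf-isCluster x∉S) λ _ _ → refl
                  ; (there X∈Ds) → ∈clustersOfType⁺ (All.lookup 𝒞-clusters (Ds⊆𝒞 X∈Ds)) (All.lookup Ds-type X∈Ds) }
    in Ds , Ds! , Ds-type , Ds⊆𝒞 , ⊓-below len (Unique-⊆⇒length≤ (≡-dec B._≟_) C∷Ds! C∷Ds⊆)
    where
    x∉S = ∉S'⇒∉S x∉S'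
    κ = typeCount G S (clusterOf x)
    ⊓-below : ∀ {k a m} → k ≡ a ⊓ m → k < m → k ≡ a
    ⊓-below {k} {a} {m} k≡ k<m with ℕ.⊓-sel a m
    ... | inj₁ a⊓m≡a = trans k≡ a⊓m≡a
    ... | inj₂ a⊓m≡m = contradiction (trans k≡ a⊓m≡m) (ℕ.<⇒≢ k<m)

  extremes : Permutation′ n → List (Fin n)
  extremes π = map (extremeNeighbour G left (pos G π)) S-list ++ map (extremeNeighbour G right (pos G π)) S-list
    where S-list = filter (_∈? S) (allFin n)

  length-extremes : ∀ π → length (extremes π) ≡ 2 * ∣ S ∣
  length-extremes π = begin
    length (extremes π)                  ≡⟨ length-++ (map (extremeNeighbour G left (pos G π)) S-list) ⟩
    length (map _ S-list) + length (map _ S-list) ≡⟨ cong₂ _+_ (length-map _ S-list) (length-map _ S-list) ⟩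
    length S-list + length S-list        ≡⟨ cong (λ k → k + k) (sym (∣p∣≡length-filter S)) ⟩
    ∣ S ∣ + ∣ S ∣                        ≡⟨ cong (∣ S ∣ +_) (sym (ℕ.+-identityʳ ∣ S ∣)) ⟩
    2 * ∣ S ∣                            ∎
    where
    open ≡-Reasoning
    S-list = filter (_∈? S) (allFin n)

  isExtreme⇒∈extremes : ∀ π side {s x} → s ∈ S → IsExtremeNeighbour G side (pos G π) s x → x ∈ᴸ extremes π
  isExtreme⇒∈extremes π side {s} s∈S x-ext@(sx , _) = subst (_∈ᴸ extremes π) (sym x≡) (in-extremes side)
    where
    p = pos G π
    S-list = filter (_∈? S) (allFin n)
    s∈ = ∈-filter⁺ (_∈? S) (∈-allFin s) s∈S
    x≡ = isExtremeNeighbour-unique G side (pos-injective G π) x-ext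
           (extremeNeighbour-isExtreme G side (λ _ → FP.toℕ<n _) sx)
    in-extremes : ∀ side → extremeNeighbour G side p s ∈ᴸ extremes π
    in-extremes left  = ∈-++⁺ˡ (∈-map⁺ _ s∈)
    in-extremes right = ∈-++⁺ʳ (map _ S-list) (∈-map⁺ _ s∈)

  meetsExtremes? : ∀ π D → Dec (∃ λ v → v ∈ D × v ∈ᴸ extremes π)
  meetsExtremes? π D = FP.any? λ v → (v ∈? D) ×-dec (v ∈ᴸ? extremes π)
    where open import Data.List.Membership.DecPropositional (_≟ᶠ_ {n}) using () renaming (_∈?_ to _∈ᴸ?_)

  -- Pigeonhole: x is one of the 2|S| extreme neighbours but lies in none of the 2|S| saturating clusters.
  extreme-free-cluster : ∀ π {x} → x ∉ S' → x ∈ᴸ extremes π →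
    ∃ λ D → D ∈ᴸ 𝒞 × HasType G S (typeCount G S (clusterOf x)) D × (∀ {v} → v ∈ D → v ∉ᴸ extremes π)
  extreme-free-cluster π {x} x∉S' x∈T with 𝒞-saturates-type x∉S'
  ... | Ds , Ds! , Ds-type , Ds⊆𝒞 , len with All.all? (meetsExtremes? π) Ds
  ...   | yes all-meet = contradiction (hitting⇒length< Ds! overlap⇒≡ all-meet x∈T x∉Ds)
                                       (ℕ.≤⇒≯ (ℕ.≤-reflexive (trans (length-extremes π) (sym len))))
    where
    overlap⇒≡ : ∀ {X Y v} → X ∈ᴸ Ds → Y ∈ᴸ Ds → v ∈ X → v ∈ Y → X ≡ Y
    overlap⇒≡ X∈ Y∈ = overlapping-clusters-≡ (All.lookup 𝒞-clusters (Ds⊆𝒞 X∈)) (All.lookup 𝒞-clusters (Ds⊆𝒞 Y∈))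
    x∉Ds : ∀ {X} → X ∈ᴸ Ds → x ∉ X
    x∉Ds X∈Ds x∈X = x∉S' (∈𝒞⇒∈S' (Ds⊆𝒞 X∈Ds) x∈X)
  ...   | no ¬all-meet =
    let D , D∈Ds , D-misses = find (¬All⇒Any¬ (meetsExtremes? π) Ds ¬all-meet)
    in D , Ds⊆𝒞 D∈Ds , All.lookup Ds-type D∈Ds , λ v∈D v∈T → D-misses (_ , v∈D , v∈T)

  BadSlot : Permutation′ n → Side → Fin n → Set
  BadSlot π side s = s ∈ S × ∃ λ x → IsExtremeNeighbour G side (pos G π) s x × x ∉ S'

  badSlot? : ∀ π side s → Dec (BadSlot π side s)
  badSlot? π side s = (s ∈? S) ×-dec FP.any? λ x → isExtremeNeighbour? G side (pos G π) s x ×-dec ¬? (x ∈? S')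

  badSlots : Permutation′ n → Side → Subset n
  badSlots π side = V.tabulate (does ∘ badSlot? π side)

  badness : Permutation′ n → ℕ
  badness π = ∣ badSlots π left ∣ + ∣ badSlots π right ∣

  module Repair {π : Permutation′ n} {x₀ : Fin n} (x₀∉S' : x₀ ∉ S') {D : Subset n} (D∈𝒞 : D ∈ᴸ 𝒞)
    (D-type : HasType G S (typeCount G S (clusterOf x₀)) D) (D-free : ∀ {v} → v ∈ D → v ∉ᴸ extremes π) where

    d : Fin n
    d = proj₁ (All.lookup 𝒞-clusters D∈𝒞)

    D≡ : D ≡ clusterOf d
    D≡ = isCluster⇒≡clusterOf (All.lookup 𝒞-clusters D∈𝒞)

    open ClusterSwap G S cds (∉S'⇒∉S x₀∉S') (proj₁ (proj₂ (All.lookup 𝒞-clusters D∈𝒞)))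
      (λ v∈C v∈D → ∉S'⇒clusterOf∩S'≡∅ x₀∉S' v∈C (∈𝒞⇒∈S' D∈𝒞 (subst (_ ∈_) (sym D≡) v∈D)))
      (λ N N⊆S → sym (trans (cong (λ X → typeCount G S X N) (sym D≡)) (D-type N N⊆S)))
      using (σ; σ-∈C; σ-fix; σ-fixes-S; swapClusters)

    π′ : Permutation′ n
    π′ = reorder G swapClusters π

    π′-bandwidth : HasBandwidthStretch G π → HasBandwidthStretch G π′
    π′-bandwidth = reorder-bandwidth G swapClusters {π}

    σ-extreme : ∀ side {s x} → s ∈ S →
      IsExtremeNeighbour G side (pos G π) s x → IsExtremeNeighbour G side (pos G π′) s (σ x)
    σ-extreme side s∈S = isExtremeNeighbour-apply G swapClusters side (σ-fixes-S s∈S)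

    -- Good extreme neighbours avoid C (disjoint from S') and D (free of extreme neighbours), so σ fixes them.
    fewer-bad : ∀ {side s} → BadSlot π′ side s → BadSlot π side s
    fewer-bad {side} {s} (s∈S , x′ , x′-ext@(sx′ , _) , x′∉S') = s∈S , y , y-ext , y∉S'
      where
      y = extremeNeighbour G side (pos G π) s
      y-ext = extremeNeighbour-isExtreme G side (λ _ → FP.toℕ<n _) sx′
      y∉S' : y ∉ S'
      y∉S' y∈S' = x′∉S' (subst (_∈ S') (sym x′≡y) y∈S')
        where
        σy≡y = σ-fix (λ y∈C → ∉S'⇒clusterOf∩S'≡∅ x₀∉S' y∈C y∈S')
                     (λ y∈D → D-free (subst (_ ∈_) (sym D≡) y∈D) (isExtreme⇒∈extremes π side s∈S y-ext))
        x′≡y = trans (isExtremeNeighbour-unique G side (pos-injective G π′) x′-ext (σ-extreme side s∈S y-ext)) σy≡y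

    slot-repaired : ∀ {side s} → IsExtremeNeighbour G side (pos G π) s x₀ → ¬ BadSlot π′ side s
    slot-repaired {side} x₀-ext (s∈S , x′ , x′-ext , x′∉S') =
      x′∉S' (subst (_∈ S') (sym x′≡σx₀) (∈𝒞⇒∈S' D∈𝒞 (subst (σ x₀ ∈_) (sym D≡) σx₀∈D)))
      where
      x′≡σx₀ = isExtremeNeighbour-unique G side (pos-injective G π′) x′-ext (σ-extreme side s∈S x₀-ext)
      σx₀∈D = proj₁ (σ-∈C (r∈clusterOf (∉S'⇒∉S x₀∉S')))

  badness-< : ∀ {π π′ side₀ s₀} → (∀ {side s} → BadSlot π′ side s → BadSlot π side s) →
    BadSlot π side₀ s₀ → ¬ BadSlot π′ side₀ s₀ → badness π′ < badness π
  badness-< {π} {π′} {side₀} fewer-bad bad ¬bad′ =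
    combine side₀ (p⊂q⇒∣p∣<∣q∣ (shrink side₀ , _ , x∈tabulate-does⁺ (badSlot? π side₀) bad ,
                                                   ¬bad′ ∘ x∈tabulate-does⁻ (badSlot? π′ side₀)))
    where
    shrink : ∀ side → badSlots π′ side ⊆ badSlots π side
    shrink side s∈ = x∈tabulate-does⁺ (badSlot? π side) (fewer-bad (x∈tabulate-does⁻ (badSlot? π′ side) s∈))
    combine : ∀ side → ∣ badSlots π′ side ∣ < ∣ badSlots π side ∣ → badness π′ < badness π
    combine left  fewer = ℕ.+-mono-<-≤ fewer (p⊆q⇒∣p∣≤∣q∣ (shrink right))
    combine right fewer = ℕ.+-mono-≤-< (p⊆q⇒∣p∣≤∣q∣ (shrink left)) fewer

  exchange : ∀ {π side₀ s₀} → HasBandwidthStretch G π → BadSlot π side₀ s₀ →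
             ∃ λ π′ → HasBandwidthStretch G π′ × badness π′ < badness π
  exchange {π} {side₀} optimal bad@(s₀∈S , x₀ , x₀-ext , x₀∉S') =
    let D , D∈𝒞 , D-type , D-free = extreme-free-cluster π x₀∉S' (isExtreme⇒∈extremes π side₀ s₀∈S x₀-ext)
        open Repair {π = π} x₀∉S' D∈𝒞 D-type D-free
    in π′ , π′-bandwidth optimal , badness-< {π} {π′} fewer-bad bad (slot-repaired x₀-ext)

  anyBadSlot? : ∀ π → Dec (∃ λ side → ∃ (BadSlot π side))
  anyBadSlot? π = map′ from to (FP.any? (badSlot? π left) ⊎-dec FP.any? (badSlot? π right))
    where
    from : ∃ (BadSlot π left) ⊎ ∃ (BadSlot π right) → ∃ λ side → ∃ (BadSlot π side)
    from (inj₁ bad) = left , bad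
    from (inj₂ bad) = right , bad
    to : (∃ λ side → ∃ (BadSlot π side)) → ∃ (BadSlot π left) ⊎ ∃ (BadSlot π right)
    to (left  , bad) = inj₁ bad
    to (right , bad) = inj₂ bad

  bandwidth-ordering-without-bad-slots : ∃ λ π → HasBandwidthStretch G π × ∀ side s → ¬ BadSlot π side s
  bandwidth-ordering-without-bad-slots =
    let π₀ , optimal₀ = bandwidth-ordering G in descend π₀ (<-wellFounded (badness π₀)) optimal₀
    where
    descend : ∀ π → Acc _<_ (badness π) → HasBandwidthStretch G π →
              ∃ λ π → HasBandwidthStretch G π × ∀ side s → ¬ BadSlot π side s
    descend π (acc smaller) optimal with anyBadSlot? π
    ... | yes (_ , _ , bad) = let π′ , optimal′ , fewer = exchange {π} optimal bad in descend π′ (smaller fewer) optimal′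
    ... | no none           = π , optimal , λ side s bad → none (side , s , bad)

  extremes-in-S' : ∃ λ π → HasBandwidthStretch G π ×
    ∀ side {s u} → s ∈ S → Adj G s u → ∃ λ x → x ∈ S' × IsExtremeNeighbour G side (pos G π) s x
  extremes-in-S' =
    let π , optimal , no-bad = bandwidth-ordering-without-bad-slots in
    π , optimal , λ side s∈S su →
      let x-ext = extremeNeighbour-isExtreme G side (λ _ → FP.toℕ<n _) su
      in _ , decidable-stable (_ ∈? S') (λ x∉S' → no-bad side _ (s∈S , _ , x-ext , x∉S')) , x-ext

lemma3 : ∀ {n : ℕ} (G : Graph n) (S S' : Subset n) →
    IsClusterDeletionSet G S → IsExtendedDeletionSet G S S' →
    Σ (Permutation′ n) λ π → HasBandwidthStretch G π ×
      (∀ s → s ∈ S → (∃ λ u → Adj G s u) →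
        (Σ (Fin n) λ vmin → vmin ∈ S' × Adj G s vmin × (∀ u → Adj G s u → pos G π vmin ≤ pos G π u)) ×
        (Σ (Fin n) λ vmax → vmax ∈ S' × Adj G s vmax × (∀ u → Adj G s u → pos G π u ≤ pos G π vmax)))
lemma3 G S _ cds (𝒞 , (𝒞! , 𝒞-clusters , 𝒞-count) , refl) =
  let π , optimal , extreme-in-S' = Exchange.extremes-in-S' G S cds 𝒞 𝒞! 𝒞-clusters 𝒞-count
  in π , optimal , λ s s∈S (_ , su) → extreme-in-S' left s∈S su , extreme-in-S' right s∈S su
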